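{- Let $R$ be a ring and $M$ a left $R$-module. Let $A_1,A_2$ be points and $\ell_1,\ell_2$ hyperplanes in $\mathbb P(M)$ such that each pair $(A_i,\ell_j)$, $i,j\in\{1,2\}$, is non-neighboring. Let $\mathbf A_1,\mathbf A_2\in M$ be lifts of $A_1,A_2$ and $\boldsymbol\ell_1,\boldsymbol\ell_2\in M^*$ lifts of $\ell_1,\ell_2$. Then $(A_1,A_2,\ell_1,\ell_2)$ is coherent if and only if $$\boldsymbol\ell_1(\mathbf A_1)\,\boldsymbol\ell_1(\mathbf A_2)^{ -1}=\boldsymbol\ell_2(\mathbf A_1)\,\boldsymbol\ell_2(\mathbf A_2)^{ -1}.$$
   Context: A point of $\mathbb P(M)$ is a free rank-one submodule $A\subset M$ that is a direct summand of $M$. A hyperplane of $\mathbb P(M)$ is a submodule $\ell\subset M$ such that $M=A\oplus\ell$ for some point $A$. A point $A$ and a hyperplane $\ell$ are non-neighboring if $M=A\oplus\ell$. $M^*=\mathrm{Hom}_R(M,R)$. A lift of a point $A$ is any $\mathbf A\in M$ generating $A$; a lift of a hyperplane $\ell$ is any $\boldsymbol\ell\in M^*$ generating the annihilator of $\ell$ (which is free of rank one). For non-neighboring $A,\ell$ with lifts $\mathbf A,\boldsymbol\ell$, the element $\boldsymbol\ell(\mathbf A)$ is a unit of $R$. The quadruple $(A_1,A_2,\ell_1,\ell_2)$ is coherent if $(A_1+A_2)\cap\ell_1=(A_1+A_2)\cap\ell_2$. -}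

module Defs where

open import Level using (Level; _⊔_; suc)
open import Algebra.Bundles using (Ring)
open import Algebra.Module.Bundles using (LeftModule)
import Algebra.Module.Construct.TensorUnit as TU
open import Algebra.Module.Morphism.Structures using (module LeftModuleMorphisms)
open import Data.Product using (Σ; ∃; _×_; _,_)
open import Function.Bundles using (_⇔_)
open import Relation.Unary using (Pred)

-- Submodules of M are represented as predicates on
-- the carrier of M (at level p) respecting the setoid equality.
module ProjGeom {r ℓr m ℓm : Level} {R : Ring r ℓr} (M : LeftModule R m ℓm) where

  open Ring R
  open LeftModule M

  record IsSubmodule {p : Level} (P : Pred Carrierᴹ p) : Set (r ⊔ m ⊔ ℓm ⊔ p) where
    field
      resp  : ∀ {x y} → x ≈ᴹ y → P x → P y
      zero∈ : P 0ᴹ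
      +∈    : ∀ {x y} → P x → P y → P (x +ᴹ y)
      *∈    : ∀ (a : Carrier) {x} → P x → P (a *ₗ x)

  _⊕ₛ_ : {p : Level} → Pred Carrierᴹ p → Pred Carrierᴹ p → Pred Carrierᴹ (m ⊔ ℓm ⊔ p)
  (P ⊕ₛ Q) x = Σ Carrierᴹ λ a → Σ Carrierᴹ λ b → P a × Q b × (x ≈ᴹ a +ᴹ b)

  _∩ₛ_ : {p q : Level} → Pred Carrierᴹ p → Pred Carrierᴹ q → Pred Carrierᴹ (p ⊔ q)
  (P ∩ₛ Q) x = P x × Q x

  IsDirectSum : {p : Level} → Pred Carrierᴹ p → Pred Carrierᴹ p → Set (m ⊔ ℓm ⊔ p)
  IsDirectSum P Q = (∀ x → (P ⊕ₛ Q) x) × (∀ x → P x → Q x → x ≈ᴹ 0ᴹ)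

  Generates : {p : Level} → Carrierᴹ → Pred Carrierᴹ p → Set (r ⊔ m ⊔ ℓm ⊔ p)
  Generates a P = ∀ x → P x ⇔ (Σ Carrier λ s → x ≈ᴹ s *ₗ a)

  FreeRankOne : {p : Level} → Pred Carrierᴹ p → Set (r ⊔ ℓr ⊔ m ⊔ ℓm ⊔ p)
  FreeRankOne P = Σ Carrierᴹ λ a → Generates a P × (∀ s → s *ₗ a ≈ᴹ 0ᴹ → s ≈ 0#)

  IsPoint : {p : Level} → Pred Carrierᴹ p → Set (r ⊔ ℓr ⊔ m ⊔ ℓm ⊔ suc p)
  IsPoint {p} A = IsSubmodule A × FreeRankOne A
    × (Σ (Pred Carrierᴹ p) λ B → IsSubmodule B × IsDirectSum A B)

  IsHyperplane : {p : Level} → Pred Carrierᴹ p → Set (r ⊔ ℓr ⊔ m ⊔ ℓm ⊔ suc p)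
  IsHyperplane {p} L = IsSubmodule L
    × (Σ (Pred Carrierᴹ p) λ A → IsPoint A × IsDirectSum A L)

  NonNeighboring : {p : Level} → Pred Carrierᴹ p → Pred Carrierᴹ p → Set (m ⊔ ℓm ⊔ p)
  NonNeighboring A L = IsDirectSum A L

  -- Elements of M* = Hom_R(M, R) (R regarded as a left module over itself).
  open LeftModuleMorphisms (LeftModule.rawLeftModule M)
                           (LeftModule.rawLeftModule (TU.leftModule {R = R}))

  record Dual : Set (r ⊔ ℓr ⊔ m ⊔ ℓm) where
    field
      fun   : Carrierᴹ → Carrier
      isHom : IsLeftModuleHomomorphism fun
  open Dual public

  IsPointLift : {p : Level} → Pred Carrierᴹ p → Carrierᴹ → Set (r ⊔ m ⊔ ℓm ⊔ p)
  IsPointLift A a = Generates a A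

  -- Lift of a hyperplane ℓ: an element f of M* generating the annihilator
  -- Ann(ℓ) = { g ∈ M* | g(ℓ) = 0 } as a (right) submodule of M*, i.e.
  -- g ∈ Ann(ℓ)  iff  g = f·s for some s ∈ R  (where (f·s)(x) = f(x) s).
  IsHyperplaneLift : {p : Level} → Pred Carrierᴹ p → Dual → Set (r ⊔ ℓr ⊔ m ⊔ ℓm ⊔ p)
  IsHyperplaneLift L f = ∀ (g : Dual) →
    (∀ x → L x → fun g x ≈ 0#) ⇔ (Σ Carrier λ s → ∀ x → fun g x ≈ fun f x * s)

  Coherent : {p : Level} → (A₁ A₂ L₁ L₂ : Pred Carrierᴹ p) → Set (m ⊔ ℓm ⊔ p)
  Coherent A₁ A₂ L₁ L₂ = ∀ x → ((A₁ ⊕ₛ A₂) ∩ₛ L₁) x ⇔ ((A₁ ⊕ₛ A₂) ∩ₛ L₂) x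

  IsInverse : Carrier → Carrier → Set ℓr
  IsInverse a u = (a * u ≈ 1#) × (u * a ≈ 1#)

-- Since 𝐥ⱼ(𝐀₂) is invertible and M = A₂ ⊕ ℓⱼ, the hyperplane ℓⱼ is exactly the
-- kernel of 𝐥ⱼ.  Hence s𝐀₁ + t𝐀₂ lies in ℓⱼ iff s 𝐥ⱼ(𝐀₁) + t 𝐥ⱼ(𝐀₂) = 0, i.e.
-- iff t = - s cⱼ with cⱼ = 𝐥ⱼ(𝐀₁) 𝐥ⱼ(𝐀₂)⁻¹.  So (A₁+A₂) ∩ ℓ₁ and (A₁+A₂) ∩ ℓ₂
-- are the "lines" t = - s c₁ and t = - s c₂, which agree iff c₁ = c₂ (test s = 1).
module Submission where

open import Defs
open import Level using (Level)
open import Algebra.Bundles using (Ring)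
open import Algebra.Module.Bundles using (LeftModule)
open import Algebra.Module.Morphism.Structures using (module LeftModuleMorphisms)
import Algebra.Module.Construct.TensorUnit as TU
import Algebra.Properties.Ring as RingProperties
open import Data.Product using (Σ; _,_; proj₂)
open import Function.Bundles using (_⇔_; mk⇔; Equivalence)
open import Relation.Unary using (Pred)
import Relation.Binary.Reasoning.Setoid as SetoidReasoning

open Equivalence using (to; from)

module RingLemmas {r ℓr : Level} (R : Ring r ℓr) where
  open Ring R
  open RingProperties R using (-‿distribˡ-*; +-inverseʳ-unique)
  open SetoidReasoning setoid

  *-rightInverse-cancel : ∀ {α u s} → α * u ≈ 1# → s * α ≈ 0# → s ≈ 0#
  *-rightInverse-cancel {α} {u} {s} αu≈1 sα≈0 = begin
    s             ≈⟨ sym (*-identityʳ s) ⟩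
    s * 1#        ≈⟨ *-congˡ (sym αu≈1) ⟩
    s * (α * u)   ≈⟨ sym (*-assoc s α u) ⟩
    (s * α) * u   ≈⟨ *-congʳ sα≈0 ⟩
    0# * u        ≈⟨ zeroˡ u ⟩
    0#            ∎

  sα+tβ≈0⇔t≈-sαβ⁻¹ : ∀ {α β u} → β * u ≈ 1# → u * β ≈ 1# → ∀ s t →
                     (s * α + t * β ≈ 0#) ⇔ (t ≈ - (s * (α * u)))
  sα+tβ≈0⇔t≈-sαβ⁻¹ {α} {β} {u} βu≈1 uβ≈1 s t = mk⇔ solve check
    where
    solve : s * α + t * β ≈ 0# → t ≈ - (s * (α * u))
    solve eq = begin
      t                ≈⟨ sym (*-identityʳ t) ⟩
      t * 1#           ≈⟨ *-congˡ (sym βu≈1) ⟩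
      t * (β * u)      ≈⟨ sym (*-assoc t β u) ⟩
      (t * β) * u      ≈⟨ *-congʳ (+-inverseʳ-unique (s * α) (t * β) eq) ⟩
      - (s * α) * u    ≈⟨ sym (-‿distribˡ-* (s * α) u) ⟩
      - (s * α * u)    ≈⟨ -‿cong (*-assoc s α u) ⟩
      - (s * (α * u))  ∎

    sαuβ≈sα : s * (α * u) * β ≈ s * α
    sαuβ≈sα = begin
      s * (α * u) * β  ≈⟨ *-assoc s (α * u) β ⟩
      s * (α * u * β)  ≈⟨ *-congˡ (*-assoc α u β) ⟩
      s * (α * (u * β)) ≈⟨ *-congˡ (*-congˡ uβ≈1) ⟩
      s * (α * 1#)     ≈⟨ *-congˡ (*-identityʳ α) ⟩
      s * α            ∎

    check : t ≈ - (s * (α * u)) → s * α + t * β ≈ 0#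
    check t≈ = begin
      s * α + t * β                  ≈⟨ +-congˡ (*-congʳ t≈) ⟩
      s * α + - (s * (α * u)) * β    ≈⟨ +-congˡ (sym (-‿distribˡ-* (s * (α * u)) β)) ⟩
      s * α + - (s * (α * u) * β)    ≈⟨ +-congˡ (-‿cong sαuβ≈sα) ⟩
      s * α + - (s * α)              ≈⟨ -‿inverseʳ (s * α) ⟩
      0#                             ∎

module Coherence {r ℓr m ℓm p : Level} (R : Ring r ℓr) (M : LeftModule R m ℓm) where
  open Ring R
  open LeftModule M
  open ProjGeom M
  open RingLemmas R
  open RingProperties R using (-‿injective)
  open LeftModuleMorphisms (LeftModule.rawLeftModule M)
                           (LeftModule.rawLeftModule (TU.leftModule {R = R}))
  open SetoidReasoning setoid

  fun-cong : (g : Dual) → ∀ {x y} → x ≈ᴹ y → fun g x ≈ fun g y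
  fun-cong g = IsLeftModuleHomomorphism.⟦⟧-cong (isHom g)

  fun-linear : (g : Dual) → ∀ s a t b →
               fun g (s *ₗ a +ᴹ t *ₗ b) ≈ s * fun g a + t * fun g b
  fun-linear g s a t b = trans (IsLeftModuleHomomorphism.+ᴹ-homo (isHom g) _ _)
    (+-cong (IsLeftModuleHomomorphism.*ₗ-homo (isHom g) s a)
            (IsLeftModuleHomomorphism.*ₗ-homo (isHom g) t b))

  ⊕ₛ-generated⇔ : ∀ {A₁ A₂ : Pred Carrierᴹ p} {a₁ a₂} → Generates a₁ A₁ → Generates a₂ A₂ →
                  ∀ x → (A₁ ⊕ₛ A₂) x ⇔ (Σ Carrier λ s → Σ Carrier λ t → x ≈ᴹ s *ₗ a₁ +ᴹ t *ₗ a₂)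
  ⊕ₛ-generated⇔ {A₁} {A₂} {a₁} {a₂} gen₁ gen₂ x = mk⇔ coefficients combination
    where
    Combination : Set _
    Combination = Σ Carrier λ s → Σ Carrier λ t → x ≈ᴹ s *ₗ a₁ +ᴹ t *ₗ a₂

    coefficients : (A₁ ⊕ₛ A₂) x → Combination
    coefficients (q₁ , q₂ , q₁∈A₁ , q₂∈A₂ , x≈) with to (gen₁ q₁) q₁∈A₁ | to (gen₂ q₂) q₂∈A₂
    ... | s , q₁≈ | t , q₂≈ = s , t , ≈ᴹ-trans x≈ (+ᴹ-cong q₁≈ q₂≈)
    combination : Combination → (A₁ ⊕ₛ A₂) x
    combination (s , t , x≈) =
      s *ₗ a₁ , t *ₗ a₂ , from (gen₁ _) (s , ≈ᴹ-refl) , from (gen₂ _) (t , ≈ᴹ-refl) , x≈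

  hyperplaneLift-vanishes : ∀ {L : Pred Carrierᴹ p} {g} → IsHyperplaneLift L g →
                            ∀ {x} → L x → fun g x ≈ 0#
  hyperplaneLift-vanishes {g = g} lift = from (lift g) (1# , λ _ → sym (*-identityʳ _)) _

  hyperplane⇔kernel : ∀ {A L : Pred Carrierᴹ p} {a g u} →
                      IsSubmodule L → IsDirectSum A L → Generates a A →
                      IsHyperplaneLift L g → IsInverse (fun g a) u →
                      ∀ x → L x ⇔ (fun g x ≈ 0#)
  hyperplane⇔kernel {L = L} {a = a} {g} subL (decompose , _) gen lift (gau≈1 , _) x =
    mk⇔ (hyperplaneLift-vanishes {L} {g} lift) kernel⊆L
    where
    kernel⊆L : fun g x ≈ 0# → L x
    kernel⊆L gx≈0 with decompose x
    ... | q , y , q∈A , y∈L , x≈q+y with to (gen q) q∈A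
    ... | s , q≈sa = IsSubmodule.resp subL (≈ᴹ-sym x≈y) y∈L
      where
      x≈sa+1y : x ≈ᴹ s *ₗ a +ᴹ 1# *ₗ y
      x≈sa+1y = ≈ᴹ-trans x≈q+y (+ᴹ-cong q≈sa (≈ᴹ-sym (*ₗ-identityˡ y)))
      sga≈0 : s * fun g a ≈ 0#
      sga≈0 = begin
        s * fun g a               ≈⟨ sym (+-identityʳ _) ⟩
        s * fun g a + 0#          ≈⟨ +-congˡ (sym (hyperplaneLift-vanishes {L} {g} lift y∈L)) ⟩
        s * fun g a + fun g y     ≈⟨ +-congˡ (sym (*-identityˡ _)) ⟩
        s * fun g a + 1# * fun g y ≈⟨ sym (fun-linear g s a 1# y) ⟩
        fun g (s *ₗ a +ᴹ 1# *ₗ y) ≈⟨ fun-cong g (≈ᴹ-sym x≈sa+1y) ⟩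
        fun g x                   ≈⟨ gx≈0 ⟩
        0#                        ∎
      q≈0 : q ≈ᴹ 0ᴹ
      q≈0 = ≈ᴹ-trans q≈sa (≈ᴹ-trans (*ₗ-cong (*-rightInverse-cancel gau≈1 sga≈0) ≈ᴹ-refl) (*ₗ-zeroˡ a))
      x≈y : x ≈ᴹ y
      x≈y = ≈ᴹ-trans x≈q+y (≈ᴹ-trans (+ᴹ-cong q≈0 ≈ᴹ-refl) (+ᴹ-identityˡ y))

  combination∈hyperplane⇔ : ∀ {A₂ L : Pred Carrierᴹ p} {a₁ a₂ g u} →
                            IsSubmodule L → IsDirectSum A₂ L → Generates a₂ A₂ →
                            IsHyperplaneLift L g → IsInverse (fun g a₂) u →
                            ∀ s t → L (s *ₗ a₁ +ᴹ t *ₗ a₂) ⇔ (t ≈ - (s * (fun g a₁ * u)))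
  combination∈hyperplane⇔ {A₂} {L} {a₁} {a₂} {g} {u} subL dec gen lift inv@(gu≈1 , ug≈1) s t = mk⇔
    (λ x∈L → to (sα+tβ≈0⇔t≈-sαβ⁻¹ gu≈1 ug≈1 s t)
                (trans (sym (fun-linear g s a₁ t a₂)) (to x∈L⇔gx≈0 x∈L)))
    (λ t≈ → from x∈L⇔gx≈0
                (trans (fun-linear g s a₁ t a₂) (from (sα+tβ≈0⇔t≈-sαβ⁻¹ gu≈1 ug≈1 s t) t≈)))
    where
    x∈L⇔gx≈0 : L (s *ₗ a₁ +ᴹ t *ₗ a₂) ⇔ (fun g (s *ₗ a₁ +ᴹ t *ₗ a₂) ≈ 0#)
    x∈L⇔gx≈0 = hyperplane⇔kernel {A₂} {L} {a₂} {g} {u} subL dec gen lift inv (s *ₗ a₁ +ᴹ t *ₗ a₂)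

  coherent⇔lines-equal : ∀ {A₁ A₂ L₁ L₂ : Pred Carrierᴹ p} {a₁ a₂ c₁ c₂} →
      Generates a₁ A₁ → Generates a₂ A₂ → IsSubmodule L₁ → IsSubmodule L₂ →
      (∀ s t → L₁ (s *ₗ a₁ +ᴹ t *ₗ a₂) ⇔ (t ≈ - (s * c₁))) →
      (∀ s t → L₂ (s *ₗ a₁ +ᴹ t *ₗ a₂) ⇔ (t ≈ - (s * c₂))) →
      Coherent A₁ A₂ L₁ L₂ ⇔ (c₁ ≈ c₂)
  coherent⇔lines-equal {A₁} {A₂} {L₁} {L₂} {a₁} {a₂} {c₁} {c₂} gen₁ gen₂ sub₁ sub₂ line₁ line₂ =
    mk⇔ slopes-equal lines-equal
    where
    transfer : ∀ {L L′ : Pred Carrierᴹ p} {c c′} → IsSubmodule L → IsSubmodule L′ →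
               (∀ s t → L (s *ₗ a₁ +ᴹ t *ₗ a₂) ⇔ (t ≈ - (s * c))) →
               (∀ s t → L′ (s *ₗ a₁ +ᴹ t *ₗ a₂) ⇔ (t ≈ - (s * c′))) →
               c ≈ c′ → ∀ x → ((A₁ ⊕ₛ A₂) ∩ₛ L) x → ((A₁ ⊕ₛ A₂) ∩ₛ L′) x
    transfer subL subL′ line line′ c≈c′ x (x∈sum , x∈L)
      with to (⊕ₛ-generated⇔ gen₁ gen₂ x) x∈sum
    ... | s , t , x≈ = x∈sum , IsSubmodule.resp subL′ (≈ᴹ-sym x≈)
      (from (line′ s t) (trans (to (line s t) (IsSubmodule.resp subL x≈ x∈L))
                               (-‿cong (*-congˡ c≈c′))))

    lines-equal : c₁ ≈ c₂ → Coherent A₁ A₂ L₁ L₂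
    lines-equal c₁≈c₂ x = mk⇔ (transfer sub₁ sub₂ line₁ line₂ c₁≈c₂ x)
                              (transfer sub₂ sub₁ line₂ line₁ (sym c₁≈c₂) x)

    slopes-equal : Coherent A₁ A₂ L₁ L₂ → c₁ ≈ c₂
    slopes-equal coh = begin
      c₁              ≈⟨ sym (*-identityˡ c₁) ⟩
      1# * c₁         ≈⟨ -‿injective (to (line₂ 1# t) (proj₂ (to (coh x) (x∈sum , x∈L₁)))) ⟩
      1# * c₂         ≈⟨ *-identityˡ c₂ ⟩
      c₂              ∎
      where
      t : Carrier
      t = - (1# * c₁)
      x : Carrierᴹ
      x = 1# *ₗ a₁ +ᴹ t *ₗ a₂
      x∈sum : (A₁ ⊕ₛ A₂) x
      x∈sum = from (⊕ₛ-generated⇔ gen₁ gen₂ x) (1# , t , ≈ᴹ-refl)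
      x∈L₁ : L₁ x
      x∈L₁ = from (line₁ 1# t) refl

proposition8p7 : ∀ {r ℓr m ℓm p : Level} (R : Ring r ℓr) (M : LeftModule R m ℓm) →
    let open Ring R
        open LeftModule M
        open ProjGeom M
    in (A₁ A₂ L₁ L₂ : Pred Carrierᴹ p) →
       IsPoint A₁ → IsPoint A₂ → IsHyperplane L₁ → IsHyperplane L₂ →
       NonNeighboring A₁ L₁ → NonNeighboring A₁ L₂ →
       NonNeighboring A₂ L₁ → NonNeighboring A₂ L₂ →
       (𝐀₁ 𝐀₂ : Carrierᴹ) → IsPointLift A₁ 𝐀₁ → IsPointLift A₂ 𝐀₂ →
       (𝐥₁ 𝐥₂ : Dual) → IsHyperplaneLift L₁ 𝐥₁ → IsHyperplaneLift L₂ 𝐥₂ →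
       (u₁ u₂ : Carrier) →
       IsInverse (fun 𝐥₁ 𝐀₂) u₁ → IsInverse (fun 𝐥₂ 𝐀₂) u₂ →
       Coherent A₁ A₂ L₁ L₂ ⇔ (fun 𝐥₁ 𝐀₁ * u₁ ≈ fun 𝐥₂ 𝐀₁ * u₂)
proposition8p7 {p = p} R M A₁ A₂ L₁ L₂ _ _ (sub₁ , _) (sub₂ , _) _ _ A₂⊕L₁ A₂⊕L₂
               𝐀₁ 𝐀₂ gen₁ gen₂ 𝐥₁ 𝐥₂ lift₁ lift₂ u₁ u₂ inv₁ inv₂ =
  coherent⇔lines-equal gen₁ gen₂ sub₁ sub₂
    (combination∈hyperplane⇔ {A₂} {L₁} {𝐀₁} {𝐀₂} {𝐥₁} sub₁ A₂⊕L₁ gen₂ lift₁ inv₁)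
    (combination∈hyperplane⇔ {A₂} {L₂} {𝐀₁} {𝐀₂} {𝐥₂} sub₂ A₂⊕L₂ gen₂ lift₂ inv₂)
  where open Coherence {p = p} R M
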